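{- Let $\langle L^0_i:i\in\omega\rangle$ and $\langle L^1_i:i\in\omega\rangle$ be sequences in $\mathcal H$ satisfying condition $(*)$, let $L_0=\sum_{\omega^*}L^0_i$, $L_1=\sum_\omega L^1_i$, and suppose $L=L_0+L_1\notin\mathcal H$. Then: (a) a set $A\subseteq L$ contains a subset isomorphic to $L$ if and only if for all $i,m\in\omega$ there is a finite $K\subseteq\omega\setminus m$ such that $L^0_i\hookrightarrow\big(\bigcup_{j\in K}L^0_j\big)\cap A$ and $L^1_i\hookrightarrow\big(\bigcup_{j\in K}L^1_j\big)\cap A$; (b) for $A,B\in\mathbb P(L)$: $A\le B$ if and only if for every $C\in\mathbb P(L)$ with $C\subseteq A$ and all $i,m\in\omega$ there is a finite $K\subseteq\omega\setminus m$ such that $L^0_i\hookrightarrow\big(\bigcup_{j\in K}L^0_j\big)\cap C\cap B$ and $L^1_i\hookrightarrow\big(\bigcup_{j\in K}L^1_j\big)\cap C\cap B$; (c) the pre-order $\langle\mathbb P(L),\le\rangle$ is $\sigma$-closed.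
   Context: $X\hookrightarrow Y$ means $X$ order-embeds into $Y$; subsets carry the induced order. $\sum_\omega L_i=L_0+L_1+\cdots$ and $\sum_{\omega^*}L_i=\cdots+L_1+L_0$. A sequence $\langle L_i:i\in\omega\rangle$ satisfies $(*)$ if for each $i$ the set $\{j:L_i\hookrightarrow L_j\}$ is infinite. $\mathcal H$ is the smallest class of order types of countable linear orders containing the one-element type and containing $\sum_\omega L_i$ and $\sum_{\omega^*}L_i$ for every sequence $\langle L_i\rangle$ in $\mathcal H$ satisfying $(*)$. $\mathbb P(L)=\{A\subseteq L:A\cong L\}$; on $\mathbb P(L)$, $A\le B$ iff for every $C\in\mathbb P(L)$ with $C\subseteq A$ there is $D\in\mathbb P(L)$ with $D\subseteq C\cap B$. A pre-order is $\sigma$-closed if every sequence $p_0\ge p_1\ge\cdots$ has a lower bound. $\omega\setminus m=\{n\in\omega:n\ge m\}$. -}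

module Defs where

open import Level using (0ℓ) renaming (suc to lsuc)
open import Data.Nat as ℕ using (ℕ; _≤_)
import Data.Nat.Properties as ℕP
open import Data.Unit using (⊤; tt)
open import Data.Empty using (⊥)
open import Data.Product using (Σ; Σ-syntax; _×_; _,_; proj₁; proj₂)
open import Data.Sum using (_⊎_; inj₁; inj₂)
open import Data.List using (List)
open import Data.List.Relation.Unary.All using (All)
open import Data.List.Membership.Propositional using (_∈_)
open import Function using (flip)
open import Relation.Nullary using (¬_)
open import Relation.Unary using (Pred; _⊆_; _∩_)
open import Relation.Binary using (Rel; Tri; tri<; tri≈; tri>; Trichotomous)
open import Relation.Binary.Structures using (IsStrictTotalOrder; IsStrictPartialOrder)
open import Relation.Binary.PropositionalEquality
  using (_≡_; refl; isEquivalence; resp₂; cong)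

record LinOrd : Set₁ where
  field
    Carrier : Set
    _<_     : Rel Carrier 0ℓ
    isSTO   : IsStrictTotalOrder _≡_ _<_

open LinOrd public using (Carrier)

_⊢_<_ : (L : LinOrd) → Carrier L → Carrier L → Set
L ⊢ x < y = LinOrd._<_ L x y

-- X ↪ Y : a strictly increasing map (= an order embedding, Y being linear)
_↪_ : LinOrd → LinOrd → Set
X ↪ Y = Σ[ f ∈ (Carrier X → Carrier Y) ] (∀ {x y} → X ⊢ x < y → Y ⊢ f x < f y)

-- X ↪ S, where S ⊆ Y carries the induced order
EmbedsInto : (X Y : LinOrd) → Pred (Carrier Y) 0ℓ → Set
EmbedsInto X Y S =
  Σ[ f ∈ (Carrier X → Carrier Y) ]
    ((∀ {x y} → X ⊢ x < y → Y ⊢ f x < f y) × (∀ x → S (f x)))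

-- X ≅ S for S ⊆ Y with the induced order: an order embedding of X into Y
-- whose image is exactly S (a bijection X → S preserving the order).
IsoOnto : (X Y : LinOrd) → Pred (Carrier Y) 0ℓ → Set
IsoOnto X Y S =
  Σ[ e ∈ EmbedsInto X Y S ] (∀ y → S y → Σ[ x ∈ Carrier X ] proj₁ e x ≡ y)

_≅_ : LinOrd → LinOrd → Set
X ≅ Y =
  Σ[ f ∈ (Carrier X → Carrier Y) ] Σ[ g ∈ (Carrier Y → Carrier X) ]
    ((∀ x → g (f x) ≡ x) × (∀ y → f (g y) ≡ y) ×
     (∀ {x y} → X ⊢ x < y → Y ⊢ f x < f y) ×
     (∀ {x y} → Y ⊢ f x < f y → X ⊢ x < y))

One : LinOrd
One = record
  { Carrier = ⊤
  ; _<_ = λ _ _ → ⊥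
  ; isSTO = record
    { isStrictPartialOrder = record
      { isEquivalence = isEquivalence
      ; irrefl = λ _ ()
      ; trans = λ ()
      ; <-resp-≈ = (λ _ ()) , (λ _ ()) }
    ; compare = λ { tt tt → tri≈ (λ ()) refl (λ ()) } } }

module LexSum (_⊏_ : Rel ℕ 0ℓ) (I : IsStrictTotalOrder _≡_ _⊏_)
              (Ls : ℕ → LinOrd) where
  private
    module I = IsStrictTotalOrder I
    C = Σ ℕ (λ i → Carrier (Ls i))
    module Li (i : ℕ) = IsStrictTotalOrder (LinOrd.isSTO (Ls i))

  data Lex : C → C → Set where
    here  : ∀ {i j x y} → i ⊏ j → Lex (i , x) (j , y)
    there : ∀ {i x y} → Ls i ⊢ x < y → Lex (i , x) (i , y)

  irr : ∀ {a b} → a ≡ b → ¬ Lex a b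
  irr refl (here p)  = I.irrefl refl p
  irr {i , _} refl (there p) = Li.irrefl i refl p

  tr : ∀ {a b c} → Lex a b → Lex b c → Lex a c
  tr (here p) (here q) = here (I.trans p q)
  tr (here p) (there q) = here p
  tr (there p) (here q) = here q
  tr {i , _} (there p) (there q) = there (Li.trans i p q)

  cmp : Trichotomous _≡_ Lex
  cmp (i , x) (j , y) with I.compare i j
  ... | tri< p _ q = tri< (here p) (λ e → I.irrefl (cong proj₁ e) p) (λ r → no r)
    where
      no : Lex (j , y) (i , x) → ⊥
      no (here r) = I.irrefl refl (I.trans p r)
      no (there r) = I.irrefl refl p
  ... | tri> q _ p = tri> (λ r → no r) (λ e → I.irrefl (cong proj₁ e) (proj₂-flip e p)) (here p)
    where
      proj₂-flip : (i , x) ≡ (j , y) → j ⊏ i → i ⊏ j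
      proj₂-flip refl r = r
      no : Lex (i , x) (j , y) → ⊥
      no (here r) = I.irrefl refl (I.trans p r)
      no (there r) = I.irrefl refl p
  ... | tri≈ _ refl _ with Li.compare i x y
  ...   | tri< a b c = tri< (there a) (λ { refl → b refl }) (λ { (here r) → I.irrefl refl r ; (there r) → c r })
  ...   | tri≈ a refl c = tri≈ (irr refl) refl (irr refl)
  ...   | tri> a b c = tri> (λ { (here r) → I.irrefl refl r ; (there r) → a r }) (λ { refl → b refl }) (there c)

  sum : LinOrd
  sum = record
    { Carrier = C
    ; _<_ = Lex
    ; isSTO = record
      { isStrictPartialOrder = record
        { isEquivalence = isEquivalence
        ; irrefl = irr
        ; trans = tr
        ; <-resp-≈ = resp₂ Lex }
      ; compare = cmp } }

ℕ>-isSTO : IsStrictTotalOrder _≡_ (flip ℕ._<_)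
ℕ>-isSTO = record
  { isStrictPartialOrder = record
    { isEquivalence = isEquivalence
    ; irrefl = λ { refl → ℕP.<-irrefl refl }
    ; trans = λ p q → ℕP.<-trans q p
    ; <-resp-≈ = resp₂ (flip ℕ._<_) }
  ; compare = λ m n → flipTri (ℕP.<-cmp m n) }
  where
    flipTri : ∀ {m n} → Tri (m ℕ.< n) (m ≡ n) (n ℕ.< m) → Tri (n ℕ.< m) (m ≡ n) (m ℕ.< n)
    flipTri (tri< a b c) = tri> c b a
    flipTri (tri≈ a b c) = tri≈ c b a
    flipTri (tri> a b c) = tri< c b a

Σω : (ℕ → LinOrd) → LinOrd
Σω = LexSum.sum ℕ._<_ ℕP.<-isStrictTotalOrder

-- Σ_{ω*} L_i = ⋯ + L_1 + L_0
Σω* : (ℕ → LinOrd) → LinOrd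
Σω* = LexSum.sum (flip ℕ._<_) ℕ>-isSTO

data SumLt (X Y : LinOrd) : Rel (Carrier X ⊎ Carrier Y) 0ℓ where
  l<l : ∀ {x x'} → X ⊢ x < x' → SumLt X Y (inj₁ x) (inj₁ x')
  l<r : ∀ {x y} → SumLt X Y (inj₁ x) (inj₂ y)
  r<r : ∀ {y y'} → Y ⊢ y < y' → SumLt X Y (inj₂ y) (inj₂ y')

_⊕_ : LinOrd → LinOrd → LinOrd
X ⊕ Y = record
  { Carrier = Carrier X ⊎ Carrier Y
  ; _<_ = SumLt X Y
  ; isSTO = record
    { isStrictPartialOrder = record
      { isEquivalence = isEquivalence
      ; irrefl = irr
      ; trans = tr
      ; <-resp-≈ = resp₂ (SumLt X Y) }
    ; compare = cmp } }
  where
    module X = IsStrictTotalOrder (LinOrd.isSTO X)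
    module Y = IsStrictTotalOrder (LinOrd.isSTO Y)
    irr : ∀ {a b} → a ≡ b → ¬ SumLt X Y a b
    irr refl (l<l p) = X.irrefl refl p
    irr refl (r<r p) = Y.irrefl refl p
    tr : ∀ {a b c} → SumLt X Y a b → SumLt X Y b c → SumLt X Y a c
    tr (l<l p) (l<l q) = l<l (X.trans p q)
    tr (l<l p) l<r = l<r
    tr l<r (r<r q) = l<r
    tr (r<r p) (r<r q) = r<r (Y.trans p q)
    cmp : Trichotomous _≡_ (SumLt X Y)
    cmp (inj₁ x) (inj₂ y) = tri< l<r (λ ()) (λ ())
    cmp (inj₂ y) (inj₁ x) = tri> (λ ()) (λ ()) l<r
    cmp (inj₁ x) (inj₁ x') with X.compare x x'
    ... | tri< a b c = tri< (l<l a) (λ { refl → b refl }) (λ { (l<l r) → c r })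
    ... | tri≈ a refl c = tri≈ (irr refl) refl (irr refl)
    ... | tri> a b c = tri> (λ { (l<l r) → a r }) (λ { refl → b refl }) (l<l c)
    cmp (inj₂ y) (inj₂ y') with Y.compare y y'
    ... | tri< a b c = tri< (r<r a) (λ { refl → b refl }) (λ { (r<r r) → c r })
    ... | tri≈ a refl c = tri≈ (irr refl) refl (irr refl)
    ... | tri> a b c = tri> (λ { (r<r r) → a r }) (λ { refl → b refl }) (r<r c)

-- Condition (*): for each i, {j : L_i ↪ L_j} is infinite (unbounded in ω)

Star : (ℕ → LinOrd) → Set
Star Ls = ∀ i m → Σ[ j ∈ ℕ ] (m ≤ j × (Ls i ↪ Ls j))

-- The class ℋ (closed under isomorphism, i.e. a class of order types)
data InH : LinOrd → Set₁ where
  one  : ∀ {L} → L ≅ One → InH L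
  sumω : ∀ {L} (Ls : ℕ → LinOrd) → (∀ i → InH (Ls i)) → Star Ls →
         L ≅ Σω Ls → InH L
  sumω* : ∀ {L} (Ls : ℕ → LinOrd) → (∀ i → InH (Ls i)) → Star Ls →
          L ≅ Σω* Ls → InH L

Subset : LinOrd → Set₁
Subset L = Pred (Carrier L) 0ℓ

-- A ∈ ℙ(L)  iff  A ⊆ L and A ≅ L
InP : (L : LinOrd) → Subset L → Set
InP L A = IsoOnto L L A

record ℙ (L : LinOrd) : Set₁ where
  constructor ⟨_,_⟩
  field
    set  : Subset L
    isoL : InP L set
open ℙ public

_≤ℙ_ : ∀ {L} → ℙ L → ℙ L → Set₁
_≤ℙ_ {L} A B = ∀ (C : ℙ L) → set C ⊆ set A →
               Σ[ D ∈ ℙ L ] (set D ⊆ (set C ∩ set B))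

σ-closed : ∀ {L} → Set₁
σ-closed {L} = ∀ (p : ℕ → ℙ L) → (∀ n → p (ℕ.suc n) ≤ℙ p n) →
               Σ[ q ∈ ℙ L ] (∀ n → q ≤ℙ p n)

module Setting (L⁰ L¹ : ℕ → LinOrd) where
  Lfull : LinOrd
  Lfull = Σω* L⁰ ⊕ Σω L¹

  U⁰ : List ℕ → Subset Lfull
  U⁰ K (inj₁ (j , _)) = j ∈ K
  U⁰ K (inj₂ _)       = ⊥

  U¹ : List ℕ → Subset Lfull
  U¹ K (inj₁ _)       = ⊥
  U¹ K (inj₂ (j , _)) = j ∈ K

  Cond : Subset Lfull → Set
  Cond S = ∀ i m → Σ[ K ∈ List ℕ ]
             (All (m ≤_) K ×
              EmbedsInto (L⁰ i) Lfull (U⁰ K ∩ S) ×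
              EmbedsInto (L¹ i) Lfull (U¹ K ∩ S))

module Submission where

-- General facts come first: under (*) a Σ_ω-sum (Σ_{ω*}-sum) has a copy of
-- itself beyond (before) each of its points, hence is indecomposable; an
-- indecomposable order lying in finitely many summands of a sum lies in one
-- of them; and no order in ℋ embeds two copies of itself side by side.  In
-- the setting of the proposition they show that L₁ embeds neither into L₀
-- nor into any summand L⁰ⱼ or L¹ⱼ (the first two using L ∉ ℋ), so every copy
-- of L₁ inside L reaches arbitrarily far right summands, and dually for L₀;
-- this gives (a) ⇒.  Conversely, witnesses of Cond for sets S₀, S₁, … taken
-- in consecutive windows of summand indices assemble into a copy of L
-- (a ⇐).  Part (b) is (a) applied to the sets C ∩ B, and (c) assembles a
-- lower bound from a refined chain, as Cond only concerns large indices.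

open import Defs
open import Level using (0ℓ) renaming (suc to lsuc)
open import Data.Nat as ℕ using (ℕ; zero; suc; _≤_; _<_; z≤n; s≤s; _≤?_; _⊔_)
open import Data.Nat.Properties as ℕP using (≤-refl; ≤-trans; <⇒≤; ≤-pred; <-≤-trans; <⇒≱; m≤n⇒m<n∨m≡n; m≤n⇒m≤1+n; ≰⇒>; n<1+n; m≤m⊔n; m≤n⊔m)
open import Data.Product using (Σ; Σ-syntax; _×_; _,_; proj₁; proj₂; uncurry; map₁)
open import Data.Sum using (_⊎_; inj₁; inj₂; swap; [_,_]′)
open import Data.Unit using (tt)
open import Data.List using (List; filter; upTo; _++_)
open import Data.List.Relation.Unary.All as All using (All)
open import Data.List.Relation.Unary.All.Properties using (all-filter; ++⁺)
open import Data.List.Membership.Propositional using (_∈_)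
open import Data.List.Membership.Propositional.Properties using (∈-filter⁺; ∈-upTo⁺; ∈-++⁺ˡ; ∈-++⁺ʳ)
open import Data.List.Extrema.Nat using (max; ⊥≤max; xs≤max)
open import Data.Empty using (⊥; ⊥-elim)
open import Function using (id; _∘_; flip)
open import Relation.Nullary using (¬_; yes; no)
open import Relation.Unary using (_⊆_; _∩_; _∪_; U)
open import Relation.Binary using (Rel)
open import Relation.Binary.Structures using (IsStrictTotalOrder)
open import Relation.Binary.PropositionalEquality using (_≡_; refl; sym; subst; subst₂)
open import Axiom.ExcludedMiddle using (ExcludedMiddle)
open import Function.Bundles using (_⇔_; mk⇔; Equivalence)
open LexSum using (here; there)

⊢-trans : (L : LinOrd) → ∀ {x y z} → L ⊢ x < y → L ⊢ y < z → L ⊢ x < z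
⊢-trans L = IsStrictTotalOrder.trans (LinOrd.isSTO L)

⊢-asym : (L : LinOrd) → ∀ {x y} → L ⊢ x < y → ¬ (L ⊢ y < x)
⊢-asym L p q = IsStrictTotalOrder.irrefl (LinOrd.isSTO L) refl (⊢-trans L p q)

_∘↪_ : ∀ {X Y Z} → Y ↪ Z → X ↪ Y → X ↪ Z
(g , g-mono) ∘↪ (f , f-mono) = g ∘ f , g-mono ∘ f-mono

_◃_ : ∀ {X Y Z P} → EmbedsInto Y Z P → X ↪ Y → EmbedsInto X Z P
(g , g-mono , g∈P) ◃ (f , f-mono) = g ∘ f , g-mono ∘ f-mono , g∈P ∘ f

underlying : ∀ {X Z P} → EmbedsInto X Z P → X ↪ Z
underlying (f , f-mono , _) = f , f-mono

weaken : ∀ {X Z} {P Q : Subset Z} → P ⊆ Q → EmbedsInto X Z P → EmbedsInto X Z Q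
weaken P⊆Q (f , f-mono , f∈P) = f , f-mono , P⊆Q ∘ f∈P

≅-refl : ∀ {X} → X ≅ X
≅-refl = id , id , (λ _ → refl) , (λ _ → refl) , id , id

≅⇒↪ : ∀ {X Y} → X ≅ Y → X ↪ Y
≅⇒↪ (f , _ , _ , _ , f-mono , _) = f , f-mono

≅⇒↩ : ∀ {X Y} → X ≅ Y → Y ↪ X
≅⇒↩ {Y = Y} (f , g , _ , fg , _ , f-refl) =
  g , λ {a} {b} a<b → f-refl (subst₂ (LinOrd._<_ Y) (sym (fg a)) (sym (fg b)) a<b)

⊕-map : ∀ {X X' Y Y'} → X ↪ X' → Y ↪ Y' → (X ⊕ Y) ↪ (X' ⊕ Y')
⊕-map {X} {X'} {Y} {Y'} (f , f-mono) (g , g-mono) = h , h-mono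
  where
    h : Carrier (X ⊕ Y) → Carrier (X' ⊕ Y')
    h (inj₁ x) = inj₁ (f x)
    h (inj₂ y) = inj₂ (g y)
    h-mono : ∀ {a b} → (X ⊕ Y) ⊢ a < b → (X' ⊕ Y') ⊢ h a < h b
    h-mono (l<l p) = l<l (f-mono p)
    h-mono l<r     = l<r
    h-mono (r<r p) = r<r (g-mono p)

point : ∀ {L} → InH L → Carrier L
point (one (_ , g , _))           = g _
point (sumω Ls hs _ (_ , g , _))  = g (0 , point (hs 0))
point (sumω* Ls hs _ (_ , g , _)) = g (0 , point (hs 0))

-- Directions: `up` is the order of ω, `down` that of ω*.  `Past d Z x y`
-- says that y lies beyond x when Z is traversed in direction d.
data Dir : Set where
  up down : Dir

opp : Dir → Dir
opp up   = down
opp down = up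

Past : Dir → (Z : LinOrd) → Rel (Carrier Z) 0ℓ
Past up   Z x y = Z ⊢ x < y
Past down Z x y = Z ⊢ y < x

Past-map : ∀ d {X Y} (f : X ↪ Y) {a b} → Past d X a b → Past d Y (proj₁ f a) (proj₁ f b)
Past-map up   (_ , f-mono) = f-mono
Past-map down (_ , f-mono) = f-mono

Indecomp : LinOrd → Set₁
Indecomp X = ∀ (Z : LinOrd) (P Q : Subset Z) → (∀ {a b} → P a → Q b → Z ⊢ a < b) →
             EmbedsInto X Z (P ∪ Q) → EmbedsInto X Z P ⊎ EmbedsInto X Z Q

indecomp-dir : ∀ {X} → Indecomp X → ∀ d (Z : LinOrd) (P Q : Subset Z) →
               (∀ {a b} → P a → Q b → Past d Z a b) →
               EmbedsInto X Z (P ∪ Q) → EmbedsInto X Z P ⊎ EmbedsInto X Z Q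
indecomp-dir ind up   Z P Q sep e = ind Z P Q sep e
indecomp-dir {X} ind down Z P Q sep e = swap (ind Z Q P (λ q p → sep p q) (weaken {X} {Z} {P ∪ Q} {Q ∪ P} swap e))

Copies : Dir → LinOrd → Set
Copies d X = ∀ x → Σ[ h ∈ X ↪ X ] (∀ y → Past d X x (proj₁ h y))

-- Classically, having copies in either direction makes X indecomposable:
-- if some point lands in the far piece, the copy beyond it lands there too.
copies⇒indecomp : ExcludedMiddle 0ℓ → ∀ d {X} → Copies d X → Indecomp X
copies⇒indecomp em up {X} cp Z P Q P<Q (f , f-mono , f∈) with em {Σ[ x ∈ Carrier X ] Q (f x)}
... | no ¬hitQ = inj₁ (f , f-mono , λ x → [P] x (f∈ x))
  where [P] : ∀ x → (P ∪ Q) (f x) → P (f x)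
        [P] x (inj₁ p) = p
        [P] x (inj₂ q) = ⊥-elim (¬hitQ (x , q))
... | yes (x , qx) with cp x
...   | (h , h-mono) , past-x = inj₂ (f ∘ h , f-mono ∘ h-mono , [Q])
  where
    [Q] : ∀ y → Q (f (h y))
    [Q] y with f∈ (h y)
    ... | inj₂ q = q
    ... | inj₁ p = ⊥-elim (⊢-asym Z (P<Q p qx) (f-mono (past-x y)))
copies⇒indecomp em down {X} cp Z P Q P<Q (f , f-mono , f∈) with em {Σ[ x ∈ Carrier X ] P (f x)}
... | no ¬hitP = inj₂ (f , f-mono , λ x → [Q] x (f∈ x))
  where [Q] : ∀ x → (P ∪ Q) (f x) → Q (f x)
        [Q] x (inj₁ p) = ⊥-elim (¬hitP (x , p))
        [Q] x (inj₂ q) = q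
... | yes (x , px) with cp x
...   | (h , h-mono) , past-x = inj₁ (f ∘ h , f-mono ∘ h-mono , [P])
  where
    [P] : ∀ y → P (f (h y))
    [P] y with f∈ (h y)
    ... | inj₁ p = p
    ... | inj₂ q = ⊥-elim (⊢-asym Z (P<Q px q) (f-mono (past-x y)))

step⇒mono : (f : ℕ → ℕ) → (∀ i → f i < f (suc i)) → ∀ {a b} → a < b → f a < f b
step⇒mono f step {a} {suc b} a<1+b with m≤n⇒m<n∨m≡n (≤-pred a<1+b)
... | inj₁ a<b  = ℕP.<-trans (step⇒mono f step a<b) (step b)
... | inj₂ refl = step a

step⇒mono≤ : (f : ℕ → ℕ) → (∀ i → f i < f (suc i)) → ∀ {a b} → a ≤ b → f a ≤ f b
step⇒mono≤ f step a≤b with m≤n⇒m<n∨m≡n a≤b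
... | inj₁ a<b  = <⇒≤ (step⇒mono f step a<b)
... | inj₂ refl = ≤-refl

ordℕ : Dir → Rel ℕ 0ℓ
ordℕ up   = ℕ._<_
ordℕ down = flip ℕ._<_

ordℕ-isSTO : ∀ d → IsStrictTotalOrder _≡_ (ordℕ d)
ordℕ-isSTO up   = ℕP.<-isStrictTotalOrder
ordℕ-isSTO down = ℕ>-isSTO

Sum : Dir → (ℕ → LinOrd) → LinOrd
Sum d = LexSum.sum (ordℕ d) (ordℕ-isSTO d)

ordℕ-mono : ∀ d {f : ℕ → ℕ} → (∀ {a b} → a < b → f a < f b) →
            ∀ {a b} → ordℕ d a b → ordℕ d (f a) (f b)
ordℕ-mono up   f-mono = f-mono
ordℕ-mono down f-mono = f-mono

beyond : ∀ d Ms {a b} → proj₁ a < proj₁ b → Past d (Sum d Ms) a b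
beyond up   Ms = here
beyond down Ms = here

initial≤ : ∀ d Ms {p z} → Past (opp d) (Sum d Ms) p z → proj₁ z ≤ proj₁ p
initial≤ up   Ms (here q)  = <⇒≤ q
initial≤ up   Ms (there _) = ≤-refl
initial≤ down Ms (here q)  = <⇒≤ q
initial≤ down Ms (there _) = ≤-refl

blockDouble : ∀ d Ms {j j'} → j < j' → Ms j ↪ Ms j' → (Ms j ⊕ Ms j) ↪ Sum d Ms
blockDouble up Ms {j} {j'} j<j' (e , e-mono) = g , g-mono
  where
    g : Carrier (Ms j ⊕ Ms j) → Carrier (Sum up Ms)
    g (inj₁ x) = j , x
    g (inj₂ x) = j' , e x
    g-mono : ∀ {a b} → (Ms j ⊕ Ms j) ⊢ a < b → Sum up Ms ⊢ g a < g b
    g-mono (l<l p) = there p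
    g-mono l<r     = here j<j'
    g-mono (r<r p) = there (e-mono p)
blockDouble down Ms {j} {j'} j<j' (e , e-mono) = g , g-mono
  where
    g : Carrier (Ms j ⊕ Ms j) → Carrier (Sum down Ms)
    g (inj₁ x) = j' , e x
    g (inj₂ x) = j , x
    g-mono : ∀ {a b} → (Ms j ⊕ Ms j) ⊢ a < b → Sum down Ms ⊢ g a < g b
    g-mono (l<l p) = there (e-mono p)
    g-mono l<r     = here j<j'
    g-mono (r<r p) = there p

doubling⇒initial : ∀ d Ms → let S = Sum d Ms in (S ⊕ S) ↪ S → Carrier S →
                   Σ[ p ∈ Carrier S ] EmbedsInto S S (Past (opp d) S p)
doubling⇒initial up   Ms (D , D-mono) s₀ = D (inj₂ s₀) , D ∘ inj₁ , D-mono ∘ l<l , λ _ → D-mono l<r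
doubling⇒initial down Ms (D , D-mono) s₀ = D (inj₁ s₀) , D ∘ inj₂ , D-mono ∘ r<r , λ _ → D-mono l<r

module Summands (d : Dir) (Ms : ℕ → LinOrd) where
  S : LinOrd
  S = Sum d Ms

  idx : Carrier S → ℕ
  idx = proj₁

  Block Upto : ℕ → Subset S
  Block j z = idx z ≡ j
  Upto k z = idx z ≤ k

  fromBlock : ∀ {X j} → EmbedsInto X S (Block j) → X ↪ Ms j
  fromBlock {X} {j} (f , f-mono , f∈) = g , λ {x} {y} x<y → read (f∈ x) (f∈ y) (f-mono x<y)
    where
      cast : ∀ {i} → i ≡ j → Carrier (Ms i) → Carrier (Ms j)
      cast = subst (λ i → Carrier (Ms i))
      g : Carrier X → Carrier (Ms j)
      g x = cast (f∈ x) (proj₂ (f x))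
      read : ∀ {a b} (pa : idx a ≡ j) (pb : idx b ≡ j) → S ⊢ a < b →
             Ms j ⊢ cast pa (proj₂ a) < cast pb (proj₂ b)
      read refl refl (here p)  = ⊥-elim (IsStrictTotalOrder.irrefl (ordℕ-isSTO d) refl p)
      read refl refl (there q) = q

  notInBlock : Star Ms → ∀ j → ¬ ((Ms j ⊕ Ms j) ↪ Ms j) → ¬ (S ↪ Ms j)
  notInBlock st j noDouble S↪Mj with st j (suc j)
  ... | j' , j<j' , Mj↪Mj' = noDouble (_∘↪_ {Ms j ⊕ Ms j} {S} {Ms j} S↪Mj (blockDouble d Ms j<j' Mj↪Mj'))

  -- Under (*), for every k the sum embeds into its part after the k-th
  -- summand: send Ms i into a summand of index targetᵢ > k, with the
  -- targets strictly increasing.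
  shift : Star Ms → ∀ k → Σ[ h ∈ S ↪ S ] (∀ z → k < idx (proj₁ h z))
  shift st k = (h , h-mono) , λ z → proj₁ (proj₂ (target (idx z)))
    where
      target : ∀ i → Σ[ j ∈ ℕ ] (k < j × (Ms i ↪ Ms j))
      target zero    = st 0 (suc k)
      target (suc i) = proj₁ next , ℕP.<-trans (proj₁ (proj₂ (target i))) (proj₁ (proj₂ next)) , proj₂ (proj₂ next)
        where
          next : Σ[ j ∈ ℕ ] (suc (proj₁ (target i)) ≤ j × (Ms (suc i) ↪ Ms j))
          next = st (suc i) (suc (proj₁ (target i)))
      τ : ℕ → ℕ
      τ i = proj₁ (target i)
      τ-step : ∀ i → τ i < τ (suc i)
      τ-step i = proj₁ (proj₂ (st (suc i) (suc (τ i))))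
      h : Carrier S → Carrier S
      h (i , x) = τ i , proj₁ (proj₂ (proj₂ (target i))) x
      h-mono : ∀ {a b} → S ⊢ a < b → S ⊢ h a < h b
      h-mono (here p)          = here (ordℕ-mono d (step⇒mono τ τ-step) p)
      h-mono {i , _} (there q) = there (proj₂ (proj₂ (proj₂ (target i))) q)

  copies : Star Ms → Copies d S
  copies st (k , _) = proj₁ (shift st k) , λ z → beyond d Ms (proj₂ (shift st k) z)

  -- An indecomposable order embedded into finitely many summands embeds
  -- into a single one (peel off the last summand with indecomposability).
  bounded⇒block : ∀ {X} → Indecomp X → ∀ k → EmbedsInto X S (Upto k) → Σ[ j ∈ ℕ ] (X ↪ Ms j)
  bounded⇒block {X} ind zero    e = 0 , fromBlock {X} (weaken {X} {S} {Upto 0} {Block 0} ℕP.n≤0⇒n≡0 e)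
  bounded⇒block {X} ind (suc k) e
    with indecomp-dir {X} ind d S (Upto k) (Block (suc k)) last (weaken {X} {S} {Upto (suc k)} {Upto k ∪ Block (suc k)} (λ {z} → split {z}) e)
    where
      split : ∀ {z} → Upto (suc k) z → (Upto k ∪ Block (suc k)) z
      split z≤1+k with m≤n⇒m<n∨m≡n z≤1+k
      ... | inj₁ z<1+k = inj₁ (≤-pred z<1+k)
      ... | inj₂ z≡1+k = inj₂ z≡1+k
      last : ∀ {a b} → Upto k a → Block (suc k) b → Past d S a b
      last a≤k refl = beyond d Ms (s≤s a≤k)
  ... | inj₁ e′ = bounded⇒block {X} ind k e′
  ... | inj₂ e′ = suc k , fromBlock {X} e′

  initial⇒block : ∀ {X p} → Indecomp X → EmbedsInto X S (Past (opp d) S p) → Σ[ j ∈ ℕ ] (X ↪ Ms j)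
  initial⇒block {X} {p} ind e = bounded⇒block {X} ind (idx p) (weaken {X} {S} {Past (opp d) S p} {Upto (idx p)} (initial≤ d Ms) e)

  opposite⇒block : ∀ {X} → Indecomp X → Copies (opp d) X → Carrier X → X ↪ S → Σ[ j ∈ ℕ ] (X ↪ Ms j)
  opposite⇒block {X} ind cp x (f , f-mono) with cp x
  ... | (h , h-mono) , past-x =
    initial⇒block {X} {f x} ind (f ∘ h , f-mono ∘ h-mono , λ y → Past-map (opp d) (f , f-mono) (past-x y))

  doubling⇒block : Indecomp S → (S ⊕ S) ↪ S → Carrier S → Σ[ j ∈ ℕ ] (S ↪ Ms j)
  doubling⇒block ind D s₀ = initial⇒block {S} ind (proj₂ (doubling⇒initial d Ms D s₀))

-- A sum under (*) of nonempty summands, none of which embeds two copies of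
-- itself side by side, does not do so either: S ⊕ S ↪ S would put a copy of
-- S into a single summand Mⱼ, while Mⱼ ⊕ Mⱼ already embeds into S.
sumNoDouble : ExcludedMiddle 0ℓ → ∀ d Ms → (∀ i → InH (Ms i)) → Star Ms →
              (∀ j → ¬ ((Ms j ⊕ Ms j) ↪ Ms j)) → ∀ {L} → L ≅ Sum d Ms → ¬ ((L ⊕ L) ↪ L)
sumNoDouble em d Ms hs st noDouble {L} iso D =
  uncurry (λ j → notInBlock st j (noDouble j))
          (doubling⇒block (copies⇒indecomp em d (copies st)) S⊕S↪S (0 , point (hs 0)))
  where
    open Summands d Ms
    S⊕S↪S : (S ⊕ S) ↪ S
    S⊕S↪S = _∘↪_ {S ⊕ S} {L ⊕ L} {S} (_∘↪_ {L ⊕ L} {L} {S} (≅⇒↪ {L} {S} iso) D)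
                 (⊕-map {S} {L} {S} {L} (≅⇒↩ {L} {S} iso) (≅⇒↩ {L} {S} iso))

noDouble : ExcludedMiddle 0ℓ → ∀ {L} → InH L → ¬ ((L ⊕ L) ↪ L)
noDouble em (one (_ , g , _ , _ , f-mono , _)) (D , D-mono) = f-mono (D-mono (l<r {x = g _} {y = g _}))
noDouble em (sumω  Ms hs st iso) = sumNoDouble em up   Ms hs st (λ j → noDouble em (hs j)) iso
noDouble em (sumω* Ms hs st iso) = sumNoDouble em down Ms hs st (λ j → noDouble em (hs j)) iso

-- Adding a new summand M at index 0, shifting the others up: in front of a
-- Σ_ω-sum, or at the right end of a Σ_{ω*}-sum.
_◂_ : LinOrd → (ℕ → LinOrd) → ℕ → LinOrd
(M ◂ Ms) zero    = M
(M ◂ Ms) (suc i) = Ms i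

◂-InH : ∀ {M Ms} → InH M → (∀ i → InH (Ms i)) → ∀ i → InH ((M ◂ Ms) i)
◂-InH hM hs zero    = hM
◂-InH hM hs (suc i) = hs i

◂-Star : ∀ {M Ms j} → Star Ms → M ↪ Ms j → Star (M ◂ Ms)
◂-Star {M} {Ms} {j} st M↪Mj zero m with st j m
... | j' , m≤j' , Mj↪Mj' = suc j' , m≤n⇒m≤1+n m≤j' , _∘↪_ {M} {Ms j} {Ms j'} Mj↪Mj' M↪Mj
◂-Star st M↪Mj (suc i) m with st i m
... | j' , m≤j' , Mi↪Mj' = suc j' , m≤n⇒m≤1+n m≤j' , Mi↪Mj'

peel-ω* : ∀ {M Ms} → (Σω* Ms ⊕ M) ≅ Σω* (M ◂ Ms)
peel-ω* {M} {Ms} = f , g , gf , fg , f-mono , f-refl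
  where
    f : Carrier (Σω* Ms ⊕ M) → Carrier (Σω* (M ◂ Ms))
    f (inj₁ (i , x)) = suc i , x
    f (inj₂ y)       = 0 , y
    g : Carrier (Σω* (M ◂ Ms)) → Carrier (Σω* Ms ⊕ M)
    g (zero , y)  = inj₂ y
    g (suc i , x) = inj₁ (i , x)
    gf : ∀ a → g (f a) ≡ a
    gf (inj₁ _) = refl
    gf (inj₂ _) = refl
    fg : ∀ b → f (g b) ≡ b
    fg (zero , _)  = refl
    fg (suc _ , _) = refl
    f-mono : ∀ {a b} → (Σω* Ms ⊕ M) ⊢ a < b → Σω* (M ◂ Ms) ⊢ f a < f b
    f-mono (l<l (here p))  = here (s≤s p)
    f-mono (l<l (there q)) = there q
    f-mono l<r             = here (s≤s z≤n)
    f-mono (r<r q)         = there q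
    f-refl : ∀ {a b} → Σω* (M ◂ Ms) ⊢ f a < f b → (Σω* Ms ⊕ M) ⊢ a < b
    f-refl {inj₁ _} {inj₁ _} (here (s≤s p)) = l<l (here p)
    f-refl {inj₁ _} {inj₁ _} (there q)      = l<l (there q)
    f-refl {inj₁ _} {inj₂ _} _              = l<r
    f-refl {inj₂ _} {inj₁ _} (here ())
    f-refl {inj₂ _} {inj₂ _} (here ())
    f-refl {inj₂ _} {inj₂ _} (there q)      = r<r q

peel-ω : ∀ {M Ms} → (M ⊕ Σω Ms) ≅ Σω (M ◂ Ms)
peel-ω {M} {Ms} = f , g , gf , fg , f-mono , f-refl
  where
    f : Carrier (M ⊕ Σω Ms) → Carrier (Σω (M ◂ Ms))
    f (inj₁ y)       = 0 , y
    f (inj₂ (i , x)) = suc i , x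
    g : Carrier (Σω (M ◂ Ms)) → Carrier (M ⊕ Σω Ms)
    g (zero , y)  = inj₁ y
    g (suc i , x) = inj₂ (i , x)
    gf : ∀ a → g (f a) ≡ a
    gf (inj₁ _) = refl
    gf (inj₂ _) = refl
    fg : ∀ b → f (g b) ≡ b
    fg (zero , _)  = refl
    fg (suc _ , _) = refl
    f-mono : ∀ {a b} → (M ⊕ Σω Ms) ⊢ a < b → Σω (M ◂ Ms) ⊢ f a < f b
    f-mono (l<l q)         = there q
    f-mono l<r             = here (s≤s z≤n)
    f-mono (r<r (here p))  = here (s≤s p)
    f-mono (r<r (there q)) = there q
    f-refl : ∀ {a b} → Σω (M ◂ Ms) ⊢ f a < f b → (M ⊕ Σω Ms) ⊢ a < b
    f-refl {inj₂ _} {inj₂ _} (here (s≤s p)) = r<r (here p)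
    f-refl {inj₂ _} {inj₂ _} (there q)      = r<r (there q)
    f-refl {inj₁ _} {inj₂ _} _              = l<r
    f-refl {inj₂ _} {inj₁ _} (here ())
    f-refl {inj₁ _} {inj₁ _} (here ())
    f-refl {inj₁ _} {inj₁ _} (there q)      = l<l q

OnLeft : ∀ A B → Subset A → Subset (A ⊕ B)
OnLeft A B P (inj₁ a) = P a
OnLeft A B P (inj₂ _) = ⊥

OnRight : ∀ A B → Subset B → Subset (A ⊕ B)
OnRight A B Q (inj₁ _) = ⊥
OnRight A B Q (inj₂ b) = Q b

module _ {A B : LinOrd} where
  halves : ∀ {P Q} {a b : Carrier (A ⊕ B)} → OnLeft A B P a → OnRight A B Q b → (A ⊕ B) ⊢ a < b
  halves {a = inj₁ _} {inj₂ _} _ _ = l<r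

  private
    left : ∀ {P} (z : Carrier (A ⊕ B)) → OnLeft A B P z → Carrier A
    left (inj₁ a) _ = a
    left-mono : ∀ {P} {a b : Carrier (A ⊕ B)} (pa : OnLeft A B P a) (pb : OnLeft A B P b) → (A ⊕ B) ⊢ a < b → A ⊢ left a pa < left b pb
    left-mono {a = inj₁ _} {inj₁ _} _ _ (l<l q) = q
    left-∈ : ∀ {P} (z : Carrier (A ⊕ B)) (pz : OnLeft A B P z) → P (left z pz)
    left-∈ (inj₁ _) p = p
    right : ∀ {Q} (z : Carrier (A ⊕ B)) → OnRight A B Q z → Carrier B
    right (inj₂ b) _ = b
    right-mono : ∀ {Q} {a b : Carrier (A ⊕ B)} (pa : OnRight A B Q a) (pb : OnRight A B Q b) → (A ⊕ B) ⊢ a < b → B ⊢ right a pa < right b pb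
    right-mono {a = inj₂ _} {inj₂ _} _ _ (r<r q) = q
    right-∈ : ∀ {Q} (z : Carrier (A ⊕ B)) (pz : OnRight A B Q z) → Q (right z pz)
    right-∈ (inj₂ _) q = q

  fromLeft : ∀ {X P} → EmbedsInto X (A ⊕ B) (OnLeft A B P) → EmbedsInto X A P
  fromLeft (f , f-mono , f∈) =
    (λ x → left (f x) (f∈ x)) , (λ {x} {y} p → left-mono (f∈ x) (f∈ y) (f-mono p)) , λ x → left-∈ (f x) (f∈ x)

  fromRight : ∀ {X Q} → EmbedsInto X (A ⊕ B) (OnRight A B Q) → EmbedsInto X B Q
  fromRight (f , f-mono , f∈) =
    (λ x → right (f x) (f∈ x)) , (λ {x} {y} p → right-mono (f∈ x) (f∈ y) (f-mono p)) , λ x → right-∈ (f x) (f∈ x)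

window : ℕ → ℕ → List ℕ
window m n = filter (m ≤?_) (upTo (suc n))

window-≥ : ∀ m n → All (m ≤_) (window m n)
window-≥ m n = all-filter (m ≤?_) (upTo (suc n))

∈-window : ∀ {m n p} → m ≤ p → p ≤ n → p ∈ window m n
∈-window {m} m≤p p≤n = ∈-filter⁺ (m ≤?_) (∈-upTo⁺ (s≤s p≤n)) m≤p

module Proposition (em : ExcludedMiddle 0ℓ) (L⁰ L¹ : ℕ → LinOrd)
                   (h⁰ : ∀ i → InH (L⁰ i)) (st⁰ : Star L⁰)
                   (h¹ : ∀ i → InH (L¹ i)) (st¹ : Star L¹)
                   (L∉ℋ : ¬ InH (Setting.Lfull L⁰ L¹)) where
  open Setting L⁰ L¹
  module Σ⁰ = Summands down L⁰
  module Σ¹ = Summands up L¹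

  L₀ L₁ : LinOrd
  L₀ = Σω* L⁰
  L₁ = Σω L¹

  index : Carrier Lfull → ℕ
  index (inj₁ (j , _)) = j
  index (inj₂ (j , _)) = j

  index-anti⁰ : ∀ {a b} → L₀ ⊢ a < b → proj₁ b ≤ proj₁ a
  index-anti⁰ = initial≤ down L⁰

  index-mono¹ : ∀ {a b} → L₁ ⊢ a < b → proj₁ a ≤ proj₁ b
  index-mono¹ = initial≤ up L¹

  -- If L₁ ↪ L⁰ⱼ then L = L₀ + L₁ would be the Σ_{ω*}-sum of L₁, L⁰₀, L⁰₁, …,
  -- which lies in ℋ; symmetrically for L₀ ↪ L¹ⱼ.
  L₁⋬L⁰ : ∀ j → ¬ (L₁ ↪ L⁰ j)
  L₁⋬L⁰ j e = L∉ℋ (sumω* (L₁ ◂ L⁰) (◂-InH (sumω L¹ h¹ st¹ (≅-refl {L₁})) h⁰) (◂-Star {L₁} {L⁰} {j} st⁰ e) peel-ω*)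

  L₀⋬L¹ : ∀ j → ¬ (L₀ ↪ L¹ j)
  L₀⋬L¹ j e = L∉ℋ (sumω (L₀ ◂ L¹) (◂-InH (sumω* L⁰ h⁰ st⁰ (≅-refl {L₀})) h¹) (◂-Star {L₀} {L¹} {j} st¹ e) peel-ω)

  L₀⋬L⁰ : ∀ j → ¬ (L₀ ↪ L⁰ j)
  L₀⋬L⁰ j = Σ⁰.notInBlock st⁰ j (noDouble em (h⁰ j))

  L₁⋬L¹ : ∀ j → ¬ (L₁ ↪ L¹ j)
  L₁⋬L¹ j = Σ¹.notInBlock st¹ j (noDouble em (h¹ j))

  L₀-indecomp : Indecomp L₀
  L₀-indecomp = copies⇒indecomp em down {L₀} (Σ⁰.copies st⁰)

  L₁-indecomp : Indecomp L₁
  L₁-indecomp = copies⇒indecomp em up {L₁} (Σ¹.copies st¹)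

  -- Neither half embeds into the other: it would land in a single summand.
  L₁⋬L₀ : ¬ (L₁ ↪ L₀)
  L₁⋬L₀ e = uncurry L₁⋬L⁰ (Σ⁰.opposite⇒block {L₁} L₁-indecomp (Σ¹.copies st¹) (0 , point (h¹ 0)) e)

  L₀⋬L₁ : ¬ (L₀ ↪ L₁)
  L₀⋬L₁ e = uncurry L₀⋬L¹ (Σ¹.opposite⇒block {L₀} L₀-indecomp (Σ⁰.copies st⁰) (0 , point (h⁰ 0)) e)

  FarLeft FarRight : ℕ → Subset Lfull
  FarLeft m  = OnLeft L₀ L₁ (λ z → m ≤ proj₁ z)
  FarRight m = OnRight L₀ L₁ (λ z → m ≤ proj₁ z)

  -- Any copy of L₁ inside L reaches arbitrarily far right summands: otherwise
  -- it lies in L₀ ∪ (L¹₀ ∪ ⋯ ∪ L¹ₘ), hence by indecomposability inside L₀ or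
  -- inside a single L¹ⱼ.
  reachesRight : (f : L₁ ↪ Lfull) → ∀ m → Σ[ y ∈ Carrier L₁ ] FarRight m (proj₁ f y)
  reachesRight (f , f-mono) m with em {Σ[ y ∈ Carrier L₁ ] FarRight m (f y)}
  ... | yes far = far
  ... | no ¬far with L₁-indecomp Lfull (OnLeft L₀ L₁ U) (OnRight L₀ L₁ (Σ¹.Upto m)) (halves {L₀} {L₁}) (f , f-mono , near)
    where
      Near : Subset Lfull
      Near = OnLeft L₀ L₁ U ∪ OnRight L₀ L₁ (Σ¹.Upto m)
      classify : ∀ z → FarRight m z ⊎ Near z
      classify (inj₁ _) = inj₂ (inj₁ tt)
      classify (inj₂ (j , _)) with m ≤? j
      ... | yes m≤j = inj₁ m≤j
      ... | no  m≰j = inj₂ (inj₂ (<⇒≤ (≰⇒> m≰j)))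
      near : ∀ y → Near (f y)
      near y = [ (λ far → ⊥-elim (¬far (y , far))) , id ]′ (classify (f y))
  ... | inj₁ e = ⊥-elim (L₁⋬L₀ (underlying {L₁} {L₀} (fromLeft {L₀} {L₁} {L₁} e)))
  ... | inj₂ e = ⊥-elim (uncurry L₁⋬L¹ (Σ¹.bounded⇒block {L₁} L₁-indecomp m (fromRight {L₀} {L₁} {L₁} e)))

  reachesLeft : (f : L₀ ↪ Lfull) → ∀ m → Σ[ y ∈ Carrier L₀ ] FarLeft m (proj₁ f y)
  reachesLeft (f , f-mono) m with em {Σ[ y ∈ Carrier L₀ ] FarLeft m (f y)}
  ... | yes far = far
  ... | no ¬far with L₀-indecomp Lfull (OnLeft L₀ L₁ (Σ⁰.Upto m)) (OnRight L₀ L₁ U) (halves {L₀} {L₁}) (f , f-mono , near)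
    where
      Near : Subset Lfull
      Near = OnLeft L₀ L₁ (Σ⁰.Upto m) ∪ OnRight L₀ L₁ U
      classify : ∀ z → FarLeft m z ⊎ Near z
      classify (inj₂ _) = inj₂ (inj₂ tt)
      classify (inj₁ (j , _)) with m ≤? j
      ... | yes m≤j = inj₁ m≤j
      ... | no  m≰j = inj₂ (inj₁ (<⇒≤ (≰⇒> m≰j)))
      near : ∀ y → Near (f y)
      near y = [ (λ far → ⊥-elim (¬far (y , far))) , id ]′ (classify (f y))
  ... | inj₁ e = ⊥-elim (uncurry L₀⋬L⁰ (Σ⁰.bounded⇒block {L₀} L₀-indecomp m (fromLeft {L₀} {L₁} {L₀} e)))
  ... | inj₂ e = ⊥-elim (L₀⋬L₁ (underlying {L₀} {L₁} (fromRight {L₀} {L₁} {L₀} e)))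

  betweenLeft : ∀ {m} {p z t : Carrier Lfull} → FarLeft m p → Lfull ⊢ z < p → Lfull ⊢ t < z →
                U⁰ (window m (index t)) z
  betweenLeft {p = inj₁ _} {inj₁ _} {inj₁ _} m≤p (l<l z<p) (l<l t<z) =
    ∈-window (≤-trans m≤p (index-anti⁰ z<p)) (index-anti⁰ t<z)
  betweenLeft {p = inj₁ _} {inj₂ _} _ () _
  betweenLeft {p = inj₁ _} {inj₁ _} {inj₂ _} _ _ ()

  betweenRight : ∀ {m} {p z t : Carrier Lfull} → FarRight m p → Lfull ⊢ p < z → Lfull ⊢ z < t →
                 U¹ (window m (index t)) z
  betweenRight {p = inj₂ _} {inj₂ _} {inj₂ _} m≤p (r<r p<z) (r<r z<t) =
    ∈-window (≤-trans m≤p (index-mono¹ p<z)) (index-mono¹ z<t)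
  betweenRight {p = inj₂ _} {inj₁ _} _ () _
  betweenRight {p = inj₂ _} {inj₂ _} {inj₁ _} _ _ ()

  Witness⁰ Witness¹ : Subset Lfull → ℕ → ℕ → Set
  Witness⁰ A i m = Σ[ K ∈ List ℕ ] (All (m ≤_) K × EmbedsInto (L⁰ i) Lfull (U⁰ K ∩ A))
  Witness¹ A i m = Σ[ K ∈ List ℕ ] (All (m ≤_) K × EmbedsInto (L¹ i) Lfull (U¹ K ∩ A))

  -- A copy of L₀ inside A contains copies of every L⁰ᵢ in a finite window of
  -- left summands beyond any m: take a far-left point f y, a summand L⁰ⱼ of
  -- L₀ beyond y containing L⁰ᵢ (by (*)), and bound the image of L⁰ⱼ by the
  -- image of the next summand.
  leftWitness : ∀ {A} → EmbedsInto L₀ Lfull A → ∀ i m → Witness⁰ A i m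
  leftWitness (f , f-mono , f∈A) i m with reachesLeft (f , f-mono) m
  ... | y , far with st⁰ i (suc (proj₁ y))
  ...   | j , y<j , (e , e-mono) =
    window m (index t) , window-≥ m (index t) , g , g-mono , λ x → betweenLeft far (below x) (above x) , f∈A _
    where
      g : Carrier (L⁰ i) → Carrier Lfull
      g x = f (j , e x)
      g-mono : ∀ {a b} → L⁰ i ⊢ a < b → Lfull ⊢ g a < g b
      g-mono a<b = f-mono (there (e-mono a<b))
      t : Carrier Lfull
      t = f (suc j , point (h⁰ (suc j)))
      below : ∀ x → Lfull ⊢ g x < f y
      below x = f-mono (here y<j)
      above : ∀ x → Lfull ⊢ t < g x
      above x = f-mono (here (n<1+n j))

  rightWitness : ∀ {A} → EmbedsInto L₁ Lfull A → ∀ i m → Witness¹ A i m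
  rightWitness (f , f-mono , f∈A) i m with reachesRight (f , f-mono) m
  ... | y , far with st¹ i (suc (proj₁ y))
  ...   | j , y<j , (e , e-mono) =
    window m (index t) , window-≥ m (index t) , g , g-mono , λ x → betweenRight far (above x) (below x) , f∈A _
    where
      g : Carrier (L¹ i) → Carrier Lfull
      g x = f (j , e x)
      g-mono : ∀ {a b} → L¹ i ⊢ a < b → Lfull ⊢ g a < g b
      g-mono a<b = f-mono (there (e-mono a<b))
      t : Carrier Lfull
      t = f (suc j , point (h¹ (suc j)))
      above : ∀ x → Lfull ⊢ f y < g x
      above x = f-mono (here y<j)
      below : ∀ x → Lfull ⊢ g x < t
      below x = f-mono (here (n<1+n j))

  U⁰-index : ∀ {K z} → U⁰ K z → index z ∈ K
  U⁰-index {z = inj₁ _} j∈K = j∈K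

  U¹-index : ∀ {K z} → U¹ K z → index z ∈ K
  U¹-index {z = inj₂ _} j∈K = j∈K

  combine : ∀ {A i m} → Witness⁰ A i m → Witness¹ A i m →
            Σ[ K ∈ List ℕ ] (All (m ≤_) K × EmbedsInto (L⁰ i) Lfull (U⁰ K ∩ A) × EmbedsInto (L¹ i) Lfull (U¹ K ∩ A))
  combine {A} {i} (K⁰ , m≤K⁰ , E⁰) (K¹ , m≤K¹ , E¹) =
    K⁰ ++ K¹ , ++⁺ m≤K⁰ m≤K¹ ,
    weaken {L⁰ i} {Lfull} {U⁰ K⁰ ∩ A} {U⁰ (K⁰ ++ K¹) ∩ A} (map₁ (U⁰-++ˡ _)) E⁰ ,
    weaken {L¹ i} {Lfull} {U¹ K¹ ∩ A} {U¹ (K⁰ ++ K¹) ∩ A} (map₁ (U¹-++ʳ _)) E¹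
    where
      U⁰-++ˡ : ∀ z → U⁰ K⁰ z → U⁰ (K⁰ ++ K¹) z
      U⁰-++ˡ (inj₁ _) j∈K⁰ = ∈-++⁺ˡ j∈K⁰
      U¹-++ʳ : ∀ z → U¹ K¹ z → U¹ (K⁰ ++ K¹) z
      U¹-++ʳ (inj₂ _) j∈K¹ = ∈-++⁺ʳ K⁰ j∈K¹

  copy⇒cond : ∀ {A} → EmbedsInto Lfull Lfull A → Cond A
  copy⇒cond {A} e i m =
    combine {A} (leftWitness {A} (_◃_ {L₀} {Lfull} {Lfull} {A} e (inj₁ , l<l)) i m)
            (rightWitness {A} (_◃_ {L₁} {Lfull} {Lfull} {A} e (inj₂ , r<r)) i m)

  -- Given sets Sᵢ ⊆ L all satisfying the condition, choose consecutive
  -- windows [startᵢ, startᵢ₊₁) of summand indices, and copies of L⁰ᵢ and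
  -- L¹ᵢ inside Sᵢ within the i-th window.  Since the windows follow each
  -- other, these copies together form a copy φ[L] of L.
  module Assemble (S : ℕ → Subset Lfull) (cond : ∀ i → Cond (S i)) where
    start : ℕ → ℕ
    start zero    = 0
    start (suc i) = suc (max (start i) (proj₁ (cond i i (start i))))

    K : ℕ → List ℕ
    K i = proj₁ (cond i i (start i))

    emb⁰ : ∀ i → EmbedsInto (L⁰ i) Lfull (U⁰ (K i) ∩ S i)
    emb⁰ i = proj₁ (proj₂ (proj₂ (cond i i (start i))))

    emb¹ : ∀ i → EmbedsInto (L¹ i) Lfull (U¹ (K i) ∩ S i)
    emb¹ i = proj₂ (proj₂ (proj₂ (cond i i (start i))))

    start≤ : ∀ {i p} → p ∈ K i → start i ≤ p
    start≤ {i} = All.lookup (proj₁ (proj₂ (cond i i (start i))))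

    <start : ∀ {i p} → p ∈ K i → p < start (suc i)
    <start {i} p∈K = s≤s (All.lookup (xs≤max (start i) (K i)) p∈K)

    start-mono : ∀ {i i'} → i ≤ i' → start i ≤ start i'
    start-mono = step⇒mono≤ start (λ i → s≤s (⊥≤max (start i) (K i)))

    apart : ∀ {i i' p p'} → p ∈ K i → p' ∈ K i' → i < i' → p < p'
    apart p∈K p'∈K i<i' = <-≤-trans (<start p∈K) (≤-trans (start-mono i<i') (start≤ p'∈K))

    left-apart : ∀ {i i' z w} → U⁰ (K i) z → U⁰ (K i') w → i' < i → Lfull ⊢ z < w
    left-apart {z = inj₁ _} {inj₁ _} z∈ w∈ i'<i = l<l (here (apart w∈ z∈ i'<i))
    left-apart {z = inj₁ _} {inj₂ _} _ () _
    left-apart {z = inj₂ _} () _ _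

    right-apart : ∀ {i i' z w} → U¹ (K i) z → U¹ (K i') w → i < i' → Lfull ⊢ z < w
    right-apart {z = inj₂ _} {inj₂ _} z∈ w∈ i<i' = r<r (here (apart z∈ w∈ i<i'))
    right-apart {z = inj₂ _} {inj₁ _} _ () _
    right-apart {z = inj₁ _} () _ _

    left-right : ∀ {K K' z w} → U⁰ K z → U¹ K' w → Lfull ⊢ z < w
    left-right {z = inj₁ _} {inj₂ _} _ _ = l<r
    left-right {z = inj₁ _} {inj₁ _} _ ()
    left-right {z = inj₂ _} () _

    φ : Carrier Lfull → Carrier Lfull
    φ (inj₁ (i , x)) = proj₁ (emb⁰ i) x
    φ (inj₂ (i , y)) = proj₁ (emb¹ i) y

    φ⁰-window : ∀ i x → U⁰ (K i) (φ (inj₁ (i , x)))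
    φ⁰-window i x = proj₁ (proj₂ (proj₂ (emb⁰ i)) x)

    φ¹-window : ∀ i y → U¹ (K i) (φ (inj₂ (i , y)))
    φ¹-window i y = proj₁ (proj₂ (proj₂ (emb¹ i)) y)

    φ-window : ∀ x → index (φ x) ∈ K (index x)
    φ-window (inj₁ (i , x)) = U⁰-index (φ⁰-window i x)
    φ-window (inj₂ (i , y)) = U¹-index (φ¹-window i y)

    φ-in-S : ∀ x → S (index x) (φ x)
    φ-in-S (inj₁ (i , x)) = proj₂ (proj₂ (proj₂ (emb⁰ i)) x)
    φ-in-S (inj₂ (i , y)) = proj₂ (proj₂ (proj₂ (emb¹ i)) y)

    φ-mono : ∀ {a b} → Lfull ⊢ a < b → Lfull ⊢ φ a < φ b
    φ-mono {inj₁ (i , x)} {inj₁ (i' , x')} (l<l (here i'<i)) = left-apart (φ⁰-window i x) (φ⁰-window i' x') i'<i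
    φ-mono {inj₁ (i , _)}                 (l<l (there q))    = proj₁ (proj₂ (emb⁰ i)) q
    φ-mono {inj₁ (i , x)} {inj₂ (i' , y)} l<r                = left-right (φ⁰-window i x) (φ¹-window i' y)
    φ-mono {inj₂ (i , y)} {inj₂ (i' , y')} (r<r (here i<i')) = right-apart (φ¹-window i y) (φ¹-window i' y') i<i'
    φ-mono {inj₂ (i , _)}                 (r<r (there q))    = proj₁ (proj₂ (emb¹ i)) q

    Image : Subset Lfull
    Image z = Σ[ x ∈ Carrier Lfull ] φ x ≡ z

    image-copy : InP Lfull Image
    image-copy = (φ , φ-mono , λ x → x , refl) , λ _ im → im

    image-tail : ∀ {n z} → Image z → start n ≤ index z → Σ[ i ∈ ℕ ] (n ≤ i × S i z)
    image-tail {n} (x , refl) beyond-n with n ≤? index x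
    ... | yes n≤i = index x , n≤i , φ-in-S x
    ... | no  n≰i = ⊥-elim (<⇒≱ (<start (φ-window x)) (≤-trans (start-mono (≰⇒> n≰i)) beyond-n))

  cond⇒copy : ∀ {A} → Cond A → Σ[ C ∈ Subset Lfull ] (C ⊆ A × InP Lfull C)
  cond⇒copy {A} c = Image , (λ { (x , refl) → φ-in-S x }) , image-copy
    where open Assemble (λ _ → A) (λ _ → c)

  inP⇒cond : ∀ {C A} → C ⊆ A → InP Lfull C → Cond A
  inP⇒cond {C} {A} C⊆A ((f , f-mono , f∈C) , _) = copy⇒cond {A} (f , f-mono , λ x → C⊆A (f∈C x))

  partA : (A : Subset Lfull) → (Σ[ C ∈ Subset Lfull ] (C ⊆ A × InP Lfull C)) ⇔ Cond A
  partA A = mk⇔ (λ { (C , C⊆A , C≅L) → inP⇒cond C⊆A C≅L }) cond⇒copy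

  -- (b) is (a) applied to the sets C ∩ B.
  partB : (A B : ℙ Lfull) → (A ≤ℙ B) ⇔ ((C : ℙ Lfull) → set C ⊆ set A → Cond (set C ∩ set B))
  partB A B = mk⇔ to from
    where
      to : A ≤ℙ B → (C : ℙ Lfull) → set C ⊆ set A → Cond (set C ∩ set B)
      to A≤B C C⊆A with A≤B C C⊆A
      ... | D , D⊆C∩B = inP⇒cond D⊆C∩B (isoL D)
      from : ((C : ℙ Lfull) → set C ⊆ set A → Cond (set C ∩ set B)) → A ≤ℙ B
      from h C C⊆A with cond⇒copy (h C C⊆A)
      ... | D , D⊆C∩B , D≅L = ⟨ D , D≅L ⟩ , D⊆C∩B

  -- The condition only concerns summands of large index: if every point of C
  -- in a summand of index ≥ N lies in B, then C ∩ B inherits the condition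
  -- from C (take the witnesses for C beyond max(m, N)).
  cond-tail : ∀ {C B : Subset Lfull} N → (∀ {z} → C z → N ≤ index z → B z) → Cond C → Cond (C ∩ B)
  cond-tail {C} {B} N far c i m = restrict (c i (m ⊔ N))
    where
      restrict : Σ[ K ∈ List ℕ ] (All ((m ⊔ N) ≤_) K × EmbedsInto (L⁰ i) Lfull (U⁰ K ∩ C) × EmbedsInto (L¹ i) Lfull (U¹ K ∩ C)) →
                 Σ[ K ∈ List ℕ ] (All (m ≤_) K × EmbedsInto (L⁰ i) Lfull (U⁰ K ∩ (C ∩ B)) × EmbedsInto (L¹ i) Lfull (U¹ K ∩ (C ∩ B)))
      restrict (K , K≥ , E⁰ , E¹) =
        K , All.map (≤-trans (m≤m⊔n m N)) K≥ ,
        weaken {L⁰ i} {Lfull} {U⁰ K ∩ C} {U⁰ K ∩ (C ∩ B)} (λ (u , cz) → u , cz , far cz (beyondN K≥ (U⁰-index u))) E⁰ ,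
        weaken {L¹ i} {Lfull} {U¹ K ∩ C} {U¹ K ∩ (C ∩ B)} (λ (u , cz) → u , cz , far cz (beyondN K≥ (U¹-index u))) E¹
        where
          beyondN : ∀ {K p} → All ((m ⊔ N) ≤_) K → p ∈ K → N ≤ p
          beyondN K≥ p∈K = ≤-trans (m≤n⊔m m N) (All.lookup K≥ p∈K)

  -- (c): refine a descending sequence p₀ ≥ p₁ ≥ ⋯ to sets sₙ ∈ ℙ(L) with
  -- sₙ ⊆ p₀ ∩ ⋯ ∩ pₙ, and assemble q from the sₙ; beyond the n-th window q
  -- lies inside pₙ, so by cond-tail and (b), q ≤ pₙ.
  σ-closure : σ-closed {Lfull}
  σ-closure p p≥ = q , q≤p
    where
      refine : ∀ n (C : ℙ Lfull) → set C ⊆ set (p n) →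
               Σ[ D ∈ ℙ Lfull ] (set D ⊆ set C × (∀ {k} → k ≤ n → set D ⊆ set (p k)))
      refine zero C C⊆p₀ = C , id , λ { z≤n → C⊆p₀ }
      refine (suc n) C C⊆pₙ₊₁ with p≥ n C C⊆pₙ₊₁
      ... | E , E⊆C∩pₙ with refine n E (λ e → proj₂ (E⊆C∩pₙ e))
      ...   | D , D⊆E , D⊆p≤n = D , D⊆C , D⊆p
        where
          D⊆C : set D ⊆ set C
          D⊆C d = proj₁ (E⊆C∩pₙ (D⊆E d))
          D⊆p : ∀ {k} → k ≤ suc n → set D ⊆ set (p k)
          D⊆p k≤1+n with m≤n⇒m<n∨m≡n k≤1+n
          ... | inj₁ k<1+n = D⊆p≤n (≤-pred k<1+n)
          ... | inj₂ refl  = λ d → C⊆pₙ₊₁ (D⊆C d)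
      s : ℕ → ℙ Lfull
      s n = proj₁ (refine n (p n) id)
      s⊆p : ∀ {n k} → k ≤ n → set (s n) ⊆ set (p k)
      s⊆p {n} = proj₂ (proj₂ (refine n (p n) id))
      open Assemble (λ n → set (s n)) (λ n → inP⇒cond id (isoL (s n)))
      q : ℙ Lfull
      q = ⟨ Image , image-copy ⟩
      q≤p : ∀ n → q ≤ℙ p n
      q≤p n = Equivalence.from (partB q (p n)) λ C C⊆q →
        cond-tail {set C} {set (p n)} (start n) (λ {z} cz far → in-p (image-tail {n} {z} (C⊆q cz) far)) (inP⇒cond id (isoL C))
        where
          in-p : ∀ {z} → Σ[ i ∈ ℕ ] (n ≤ i × set (s i) z) → set (p n) z
          in-p (i , n≤i , z∈sᵢ) = s⊆p n≤i z∈sᵢ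

-- Proposition 5.2.
proposition5p2 : ExcludedMiddle 0ℓ → ExcludedMiddle (lsuc 0ℓ) →
    (L⁰ L¹ : ℕ → LinOrd) →
    (∀ i → InH (L⁰ i)) → Star L⁰ →
    (∀ i → InH (L¹ i)) → Star L¹ →
    ¬ InH (Setting.Lfull L⁰ L¹) →
    ((A : Subset (Setting.Lfull L⁰ L¹)) →
       (Σ[ C ∈ Subset (Setting.Lfull L⁰ L¹) ]
          (C ⊆ A × InP (Setting.Lfull L⁰ L¹) C))
       ⇔ Setting.Cond L⁰ L¹ A)
    ×
    ((A B : ℙ (Setting.Lfull L⁰ L¹)) →
       (A ≤ℙ B) ⇔
       ((C : ℙ (Setting.Lfull L⁰ L¹)) → set C ⊆ set A →
          Setting.Cond L⁰ L¹ (set C ∩ set B)))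
    ×
    σ-closed {Setting.Lfull L⁰ L¹}
proposition5p2 em _ L⁰ L¹ h⁰ st⁰ h¹ st¹ L∉ℋ = partA , partB , σ-closure
  where open Proposition em L⁰ L¹ h⁰ st⁰ h¹ st¹ L∉ℋ
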